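{- Let $X$ be a finite set and let $\tau$ be a non-empty subset of $\binom{X}{2}$. Then $\tau$ is thin if and only if $\tau$ is total-order flexible.
   Context: With $L(\tau)=\bigcup_{s\in\tau}s$, a non-empty $\tau\subseteq\binom{X}{2}$ is thin if $|L(\tau')|-|\tau'|-1\ge 0$ for every non-empty $\tau'\subseteq\tau$. The set $\tau$ is total-order flexible if for every choice, for each $\{x,y\}\in\tau$, of one of the orderings $x\prec y$ or $y\prec x$, there exists a total order on $X$ agreeing with all the chosen orderings. -}

module Defs where

open import Data.Nat using (ℕ; _+_; _≤_)
open import Data.Fin using (Fin)
open import Data.Fin.Subset using (Subset; ⊥; _∪_; ∣_∣; ⁅_⁆)
open import Data.List using (List; []; _∷_; length; foldr; lookup)
open import Data.List.Relation.Unary.All using (All)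
open import Data.List.Relation.Unary.Unique.Propositional using (Unique)
open import Data.List.Relation.Binary.Sublist.Propositional using (_⊆_)
open import Data.Product using (Σ; _×_; proj₁; proj₂)
open import Relation.Binary.PropositionalEquality using (_≡_; _≢_)
open import Relation.Binary.Structures using (IsStrictTotalOrder)
open import Relation.Binary.Core using (Rel)
open import Level using (0ℓ)

-- A family τ ⊆ (X choose 2) with X = Fin n: a duplicate-free, non-empty
-- list of subsets of Fin n, each of cardinality 2.
IsPairFamily : ∀ {n} → List (Subset n) → Set
IsPairFamily τ = (τ ≢ []) × Unique τ × All (λ s → ∣ s ∣ ≡ 2) τ

L : ∀ {n} → List (Subset n) → Subset n
L τ = foldr _∪_ ⊥ τ

-- thin: for every non-empty τ' ⊆ τ, |L(τ')| - |τ'| - 1 ≥ 0,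
-- i.e. |τ'| + 1 ≤ |L(τ')|.  (Sub-families are sublists of the duplicate-free τ.)
Thin : ∀ {n} → List (Subset n) → Set
Thin τ = ∀ τ' → τ' ⊆ τ → τ' ≢ [] → length τ' + 1 ≤ ∣ L τ' ∣

-- An orientation of τ: for each member s of τ (by position), an ordered pair
-- (x , y), meaning x ≺ y, with {x , y} = s.
Orientation : ∀ {n} → List (Subset n) → Set
Orientation {n} τ =
  (i : Fin (length τ)) → Σ (Fin n × Fin n) λ p → ⁅ proj₁ p ⁆ ∪ ⁅ proj₂ p ⁆ ≡ lookup τ i

TotalOrderFlexible : ∀ {n} → List (Subset n) → Set₁
TotalOrderFlexible {n} τ =
  (o : Orientation τ) →
  Σ (Rel (Fin n) 0ℓ) λ _≺_ →
    IsStrictTotalOrder _≡_ _≺_ ×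
    ((i : Fin (length τ)) → proj₁ (proj₁ (o i)) ≺ proj₂ (proj₁ (o i)))

-- Both properties are equivalent to 1-degeneracy: every non-empty subfamily σ ⊆ τ has a leaf,
-- a vertex lying in exactly one member of σ. A thin σ has one by double counting: if every
-- vertex of L(σ) had degree ≥ 2, then 2|L(σ)| ≤ Σ deg = 2|σ|. Conversely, deleting a leaf
-- together with its pair lowers |σ| and |L(σ)| by one each, which gives thinness by induction;
-- the same induction ranks X compatibly with any orientation, placing the leaf just below or
-- just above its neighbour. Finally, a leafless non-empty σ carries a walk that never returns
-- to the vertex it just left; its first repeated vertex closes a cycle of length at least 3,
-- and orienting that cycle cyclically leaves no compatible total order.

module Submission where

open import Defs
open import Data.Bool as Bool using (if_then_else_)
open import Data.Fin using (Fin; zero; suc; toℕ; fromℕ<; _≟_)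
open import Data.Fin.Properties using (any?; toℕ<n; toℕ-fromℕ<; toℕ-injective; pigeonhole)
open import Data.Fin.Subset using (Subset; inside; outside; ⁅_⁆; _∪_; ∣_∣)
  renaming (⊥ to ∅; _∈_ to _∈ₛ_; _∉_ to _∉ₛ_; _⊆_ to _⊆ₛ_)
open import Data.Fin.Subset.Properties
  using (_∈?_; x∈p∪q⁻; x∈p∪q⁺; x∈⁅x⁆; x∈⁅y⁆⇒x≡y; ∣⁅x⁆∣≡1; ∪-comm; ∪-idem; ∪-identityˡ; ∪-identityʳ; ∉⊥; p⊂q⇒∣p∣<∣q∣)
open import Data.List using (List; []; _∷_; [_]; length; map; filter; tabulate; lookup)
open import Data.List.Properties using (filter-some; map-tabulate; tabulate-cong; tabulate-lookup)
open import Data.List.Membership.Propositional using (lose) renaming (_∈_ to _∈ₗ_)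
open import Data.List.Membership.Propositional.Properties using (∈-filter⁺; ∈-filter⁻; ∈-map⁺; ∈-tabulate⁺; ∈-lookup)
open import Data.List.Relation.Unary.All as All using (All; []; _∷_)
open import Data.List.Relation.Unary.All.Properties using (all-filter; All¬⇒¬Any)
open import Data.List.Relation.Unary.Any as Any using (Any; here; there)
open import Data.List.Relation.Unary.Any.Properties using (lookup-index)
open import Data.List.Relation.Unary.AllPairs using ([]; _∷_)
open import Data.List.Relation.Unary.Unique.Propositional using (Unique)
import Data.List.Relation.Unary.Unique.Propositional.Properties as Unique
open import Data.List.Relation.Binary.Sublist.Propositional using (_⊆_; []; _∷_; _∷ʳ_; ⊆-refl; ⊆-trans)
open import Data.List.Relation.Binary.Sublist.Propositional.Properties using (All-resp-⊆; Any-resp-⊆; filter-⊆; map⁺)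
open import Data.Nat using (ℕ; zero; suc; _+_; _*_; _≤_; _<_; z≤n; s≤s)
open import Data.Nat.Properties as ℕ hiding (_≟_)
open import Algebra.Properties.CommutativeMonoid.Sum +-0-commutativeMonoid
  using (sum; ∑-distrib-+; sum-cong-≗; sum-replicate-zero)
open import Data.Product using (Σ; ∃; ∃₂; _×_; _,_; proj₁; proj₂; uncurry)
open import Data.Sum using (_⊎_; inj₁; inj₂)
open import Data.Vec using ([]; _∷_)
open import Data.Vec.Properties using (≡-dec)
open import Function using (_∘_)
open import Function.Definitions using (Injective)
open import Relation.Binary.Definitions using (DecidableEquality; Trichotomous; tri<; tri≈; tri>)
open import Relation.Binary.Structures.Biased using (isStrictTotalOrderᶜ)
open import Relation.Binary.PropositionalEquality as ≡
  using (_≡_; _≢_; refl; sym; trans; cong; subst; module ≡-Reasoning)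
open import Relation.Binary.Structures using (IsStrictTotalOrder)
open import Relation.Nullary using (¬_; yes; no; does; contradiction)
open import Relation.Unary using (Pred; Decidable)
open import Relation.Unary.Properties using (∁?)

variable
  n : ℕ

IsPair : Subset n → Set
IsPair s = ∣ s ∣ ≡ 2

module _ {a p} {A : Set a} {P : Pred A p} (P? : Decidable P) where

  length-filter-∁ : ∀ xs → length xs ≡ length (filter P? xs) + length (filter (∁? P?) xs)
  length-filter-∁ [] = refl
  length-filter-∁ (x ∷ xs) with P? x
  ... | yes _ = cong suc (length-filter-∁ xs)
  ... | no _ = trans (cong suc (length-filter-∁ xs)) (sym (+-suc _ _))

  length-filter-map : ∀ {b} {B : Set b} (f : B → A) xs →
    length (filter P? (map f xs)) ≡ length (filter (P? ∘ f) xs)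
  length-filter-map f [] = refl
  length-filter-map f (x ∷ xs) with P? (f x)
  ... | yes _ = cong suc (length-filter-map f xs)
  ... | no _ = length-filter-map f xs

Unique-resp-⊆ : ∀ {a} {A : Set a} {xs ys : List A} → xs ⊆ ys → Unique ys → Unique xs
Unique-resp-⊆ [] [] = []
Unique-resp-⊆ (_ ∷ʳ xs⊆ys) (_ ∷ ys!) = Unique-resp-⊆ xs⊆ys ys!
Unique-resp-⊆ (refl ∷ xs⊆ys) (y∉ys ∷ ys!) = All-resp-⊆ xs⊆ys y∉ys ∷ Unique-resp-⊆ xs⊆ys ys!

∈-avoiding : ∀ {a} {A : Set a} → DecidableEquality A → ∀ {xs : List A} → Unique xs → 2 ≤ length xs →
  ∀ z → ∃ λ x → x ∈ₗ xs × x ≢ z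
∈-avoiding _ {_ ∷ []} _ (s≤s ()) _
∈-avoiding _≟ₐ_ {x ∷ y ∷ _} ((x≢y ∷ _) ∷ _) _ z with x ≟ₐ z
... | yes refl = y , there (here refl) , x≢y ∘ sym
... | no x≢z = x , here refl , x≢z

edge : Fin n → Fin n → Subset n
edge a b = ⁅ a ⁆ ∪ ⁅ b ⁆

module _ {a b : Fin n} where

  ∈-edgeˡ : a ∈ₛ edge a b
  ∈-edgeˡ = x∈p∪q⁺ (inj₁ (x∈⁅x⁆ a))

  ∈-edgeʳ : b ∈ₛ edge a b
  ∈-edgeʳ = x∈p∪q⁺ {p = ⁅ a ⁆} (inj₂ (x∈⁅x⁆ b))

  ∈-edge⁻ : ∀ {x} → x ∈ₛ edge a b → x ≡ a ⊎ x ≡ b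
  ∈-edge⁻ x∈ with x∈p∪q⁻ ⁅ a ⁆ ⁅ b ⁆ x∈
  ... | inj₁ x∈a = inj₁ (x∈⁅y⁆⇒x≡y a x∈a)
  ... | inj₂ x∈b = inj₂ (x∈⁅y⁆⇒x≡y b x∈b)

  edge-comm : edge a b ≡ edge b a
  edge-comm = ∪-comm ⁅ a ⁆ ⁅ b ⁆

  ∣edge∣≡2⇒≢ : ∣ edge a b ∣ ≡ 2 → a ≢ b
  ∣edge∣≡2⇒≢ ∣ab∣≡2 refl with trans (sym ∣ab∣≡2) (trans (cong ∣_∣ (∪-idem ⁅ a ⁆)) (∣⁅x⁆∣≡1 a))
  ... | ()

edge-injective : ∀ {a b c d : Fin n} → c ≢ d → edge a b ≡ edge c d →
  (a ≡ c × b ≡ d) ⊎ (a ≡ d × b ≡ c)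
edge-injective c≢d ab≡cd
  with ∈-edge⁻ (subst (_ ∈ₛ_) (sym ab≡cd) ∈-edgeˡ) | ∈-edge⁻ (subst (_ ∈ₛ_) (sym ab≡cd) ∈-edgeʳ)
... | inj₁ c≡a | inj₁ d≡a = contradiction (trans c≡a (sym d≡a)) c≢d
... | inj₁ c≡a | inj₂ d≡b = inj₁ (sym c≡a , sym d≡b)
... | inj₂ c≡b | inj₁ d≡a = inj₂ (sym d≡a , sym c≡b)
... | inj₂ c≡b | inj₂ d≡b = contradiction (trans c≡b (sym d≡b)) c≢d

∣s∣≡0⇒s≡∅ : (s : Subset n) → ∣ s ∣ ≡ 0 → s ≡ ∅
∣s∣≡0⇒s≡∅ [] _ = refl
∣s∣≡0⇒s≡∅ (outside ∷ s) ∣s∣≡0 = cong (outside ∷_) (∣s∣≡0⇒s≡∅ s ∣s∣≡0)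

∣s∣≡1⇒singleton : (s : Subset n) → ∣ s ∣ ≡ 1 → ∃ λ a → ⁅ a ⁆ ≡ s
∣s∣≡1⇒singleton (outside ∷ s) ∣s∣≡1 with ∣s∣≡1⇒singleton s ∣s∣≡1
... | a , ⁅a⁆≡s = suc a , cong (outside ∷_) ⁅a⁆≡s
∣s∣≡1⇒singleton (inside ∷ s) ∣s∣≡1 = zero , cong (inside ∷_) (sym (∣s∣≡0⇒s≡∅ s (suc-injective ∣s∣≡1)))

∣s∣≡2⇒edge : (s : Subset n) → ∣ s ∣ ≡ 2 → ∃₂ λ a b → edge a b ≡ s
∣s∣≡2⇒edge (outside ∷ s) ∣s∣≡2 with ∣s∣≡2⇒edge s ∣s∣≡2
... | a , b , ab≡s = suc a , suc b , cong (outside ∷_) ab≡s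
∣s∣≡2⇒edge (inside ∷ s) ∣s∣≡2 with ∣s∣≡1⇒singleton s (suc-injective ∣s∣≡2)
... | b , ⁅b⁆≡s = zero , suc b , cong (inside ∷_) (trans (∪-identityˡ ⁅ b ⁆) ⁅b⁆≡s)

other-end : ∀ {s : Subset n} → ∣ s ∣ ≡ 2 → ∀ {u} → u ∈ₛ s → ∃ λ w → w ≢ u × edge u w ≡ s
other-end {s = s} ∣s∣≡2 u∈s with ∣s∣≡2⇒edge s ∣s∣≡2
... | a , b , refl with ∣edge∣≡2⇒≢ ∣s∣≡2 | ∈-edge⁻ u∈s
...   | a≢b | inj₁ refl = b , a≢b ∘ sym , refl
...   | a≢b | inj₂ refl = a , a≢b , edge-comm

∈L⁺ : ∀ {σ : List (Subset n)} {u} → Any (u ∈ₛ_) σ → u ∈ₛ L σ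
∈L⁺ (here u∈s) = x∈p∪q⁺ (inj₁ u∈s)
∈L⁺ {σ = s ∷ _} (there u∈σ) = x∈p∪q⁺ {p = s} (inj₂ (∈L⁺ u∈σ))

∈L⁻ : ∀ (σ : List (Subset n)) {u} → u ∈ₛ L σ → Any (u ∈ₛ_) σ
∈L⁻ [] u∈∅ = contradiction u∈∅ ∉⊥
∈L⁻ (s ∷ σ) u∈L with x∈p∪q⁻ s (L σ) u∈L
... | inj₁ u∈s = here u∈s
... | inj₂ u∈Lσ = there (∈L⁻ σ u∈Lσ)

L-mono : ∀ {σ τ : List (Subset n)} → σ ⊆ τ → L σ ⊆ₛ L τ
L-mono {σ = σ} σ⊆τ = ∈L⁺ ∘ Any-resp-⊆ σ⊆τ ∘ ∈L⁻ σ

deg : Fin n → List (Subset n) → ℕ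
deg u σ = length (filter (u ∈?_) σ)

∈L⇒1≤deg : ∀ (σ : List (Subset n)) {u} → u ∈ₛ L σ → 1 ≤ deg u σ
∈L⇒1≤deg σ u∈L = filter-some (_ ∈?_) (∈L⁻ σ u∈L)

1≤deg⇒∈L : ∀ (σ : List (Subset n)) {u} → 1 ≤ deg u σ → u ∈ₛ L σ
1≤deg⇒∈L σ {u} 1≤deg with filter (u ∈?_) σ in eq
... | x ∷ _ with ∈-filter⁻ (u ∈?_) {xs = σ} (subst (x ∈ₗ_) (sym eq) (here refl))
...   | x∈σ , u∈x = ∈L⁺ (lose x∈σ u∈x)

Leafless : List (Subset n) → Set
Leafless σ = ∀ u → u ∈ₛ L σ → 2 ≤ deg u σ

leaf? : (σ : List (Subset n)) → (∃ λ u → deg u σ ≡ 1) ⊎ Leafless σ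
leaf? σ with any? (λ u → deg u σ ℕ.≟ 1)
... | yes leaf = inj₁ leaf
... | no ∄leaf = inj₂ λ u u∈L → ≤∧≢⇒< (∈L⇒1≤deg σ u∈L) (λ 1≡deg → ∄leaf (u , sym 1≡deg))

prune : Fin n → List (Subset n) → List (Subset n)
prune u = filter (∁? (u ∈?_))

length-prune : ∀ u (σ : List (Subset n)) → length σ ≡ deg u σ + length (prune u σ)
length-prune u = length-filter-∁ (u ∈?_)

∣L-prune∣<∣L∣ : ∀ (σ : List (Subset n)) u → 1 ≤ deg u σ → ∣ L (prune u σ) ∣ < ∣ L σ ∣
∣L-prune∣<∣L∣ σ u 1≤deg = p⊂q⇒∣p∣<∣q∣ (L-mono (filter-⊆ (∁? (u ∈?_)) σ) , u , u∈Lσ , u∉Lσ')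
  where
  u∈Lσ : u ∈ₛ L σ
  u∈Lσ = 1≤deg⇒∈L σ 1≤deg
  u∉Lσ' : u ∉ₛ L (prune u σ)
  u∉Lσ' u∈ = All¬⇒¬Any (all-filter (∁? (u ∈?_)) σ) (∈L⁻ (prune u σ) u∈)

-- Double counting

indicator : Subset n → Fin n → ℕ
indicator s u = if does (u ∈? s) then 1 else 0

sum-indicator : (s : Subset n) → sum (indicator s) ≡ ∣ s ∣
sum-indicator [] = refl
sum-indicator (inside ∷ s) = cong suc (sum-indicator s)
sum-indicator (outside ∷ s) = sum-indicator s

deg-∷ : ∀ u (s : Subset n) σ → deg u (s ∷ σ) ≡ indicator s u + deg u σ
deg-∷ u s σ with u ∈? s
... | yes _ = refl
... | no _ = refl

sum-mono-≤ : ∀ {f g : Fin n → ℕ} → (∀ u → f u ≤ g u) → sum f ≤ sum g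
sum-mono-≤ {zero} f≤g = z≤n
sum-mono-≤ {suc n} f≤g = +-mono-≤ (f≤g zero) (sum-mono-≤ (f≤g ∘ suc))

handshake : (σ : List (Subset n)) → All IsPair σ →
  sum (λ u → deg u σ) ≡ length σ + length σ
handshake {n} [] [] = sum-replicate-zero n
handshake (s ∷ σ) (∣s∣≡2 ∷ ∣σ∣≡2) = begin
  sum (λ u → deg u (s ∷ σ))                ≡⟨ sum-cong-≗ (λ u → deg-∷ u s σ) ⟩
  sum (λ u → indicator s u + deg u σ)      ≡⟨ ∑-distrib-+ (indicator s) (λ u → deg u σ) ⟩
  sum (indicator s) + sum (λ u → deg u σ)  ≡⟨ ≡.cong₂ _+_ (trans (sum-indicator s) ∣s∣≡2) (handshake σ ∣σ∣≡2) ⟩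
  2 + (length σ + length σ)                ≡⟨ cong suc (sym (+-suc (length σ) (length σ))) ⟩
  suc (length σ) + suc (length σ)          ∎
  where open ≡-Reasoning

leafless⇒∣L∣≤length : (σ : List (Subset n)) → All IsPair σ → Leafless σ → ∣ L σ ∣ ≤ length σ
leafless⇒∣L∣≤length σ sizes leafless = ≮⇒≥ λ len<∣L∣ → <⇒≱ (+-mono-< len<∣L∣ len<∣L∣) double-bound
  where
  twice-indicator≤deg : ∀ u → indicator (L σ) u + indicator (L σ) u ≤ deg u σ
  twice-indicator≤deg u with u ∈? L σ
  ... | yes u∈L = leafless u u∈L
  ... | no _ = z≤n
  double-bound : ∣ L σ ∣ + ∣ L σ ∣ ≤ length σ + length σ
  double-bound = begin
    ∣ L σ ∣ + ∣ L σ ∣                                    ≡⟨ ≡.cong₂ _+_ (sum-indicator (L σ)) (sum-indicator (L σ)) ⟨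
    sum (indicator (L σ)) + sum (indicator (L σ))        ≡⟨ ∑-distrib-+ (indicator (L σ)) (indicator (L σ)) ⟨
    sum (λ u → indicator (L σ) u + indicator (L σ) u)    ≤⟨ sum-mono-≤ twice-indicator≤deg ⟩
    sum (λ u → deg u σ)                                  ≡⟨ handshake σ sizes ⟩
    length σ + length σ                                  ∎
    where open ≤-Reasoning

-- Thinness and 1-degeneracy

OneDegenerate : List (Subset n) → Set
OneDegenerate τ = ∀ σ → σ ⊆ τ → σ ≢ [] → ∃ λ u → deg u σ ≡ 1

module _ {τ : List (Subset n)} (sizes : All IsPair τ) where

  thin⇒oneDegenerate : Thin τ → OneDegenerate τ
  thin⇒oneDegenerate thin σ σ⊆τ σ≢[] with leaf? σ
  ... | inj₁ leaf = leaf
  ... | inj₂ leafless = contradiction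
    (leafless⇒∣L∣≤length σ (All-resp-⊆ σ⊆τ sizes) leafless)
    (<⇒≱ (subst (_≤ ∣ L σ ∣) (+-comm (length σ) 1) (thin σ σ⊆τ σ≢[])))

  module _ (degenerate : OneDegenerate τ) where

    length+1≤∣L∣ : ∀ k σ → σ ⊆ τ → length σ ≡ suc k → length σ + 1 ≤ ∣ L σ ∣
    length+1≤∣L∣ zero (s ∷ []) s⊆τ _ with All-resp-⊆ s⊆τ sizes
    ... | ∣s∣≡2 ∷ [] = ≤-reflexive (sym (trans (cong ∣_∣ (∪-identityʳ s)) ∣s∣≡2))
    length+1≤∣L∣ (suc k) σ@(_ ∷ _) σ⊆τ len with degenerate σ σ⊆τ (λ ())
    ... | u , leaf = begin
      length σ + 1         ≡⟨ cong (_+ 1) length-σ ⟨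
      suc (length σ' + 1)  ≤⟨ s≤s (length+1≤∣L∣ k σ' σ'⊆τ (suc-injective (trans length-σ len))) ⟩
      suc ∣ L σ' ∣         ≤⟨ ∣L-prune∣<∣L∣ σ u (≤-reflexive (sym leaf)) ⟩
      ∣ L σ ∣              ∎
      where
      open ≤-Reasoning
      σ' : List (Subset n)
      σ' = prune u σ
      σ'⊆τ : σ' ⊆ τ
      σ'⊆τ = ⊆-trans (filter-⊆ (∁? (u ∈?_)) σ) σ⊆τ
      length-σ : suc (length σ') ≡ length σ
      length-σ = sym (trans (length-prune u σ) (cong (_+ length σ') leaf))

    oneDegenerate⇒thin : Thin τ
    oneDegenerate⇒thin [] _ []≢[] = contradiction refl []≢[]
    oneDegenerate⇒thin (s ∷ σ) sσ⊆τ _ = length+1≤∣L∣ (length σ) (s ∷ σ) sσ⊆τ refl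

-- Rankings

rank-isStrictTotalOrder : ∀ {a} {A : Set a} (r : A → ℕ) → Injective _≡_ _≡_ r →
  IsStrictTotalOrder _≡_ (λ x y → r x < r y)
rank-isStrictTotalOrder r r-injective = isStrictTotalOrderᶜ record
  { isEquivalence = ≡.isEquivalence ; trans = <-trans ; compare = compare }
  where
  compare : Trichotomous _≡_ (λ x y → r x < r y)
  compare x y with <-cmp (r x) (r y)
  ... | tri< lt ¬eq ¬gt = tri< lt (¬eq ∘ cong r) ¬gt
  ... | tri≈ ¬lt eq ¬gt = tri≈ ¬lt (r-injective eq) ¬gt
  ... | tri> ¬lt ¬eq gt = tri> ¬lt (¬eq ∘ cong r) gt

module _ (r : Fin n → ℕ) (u : Fin n) (c : ℕ) where

  -- The odd values 2 r z + 1 keep the order of r, leaving the even slot 2 c for u.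
  insertRank : Fin n → ℕ
  insertRank z = if does (z ≟ u) then 2 * c else suc (2 * r z)

  insertRank-here : insertRank u ≡ 2 * c
  insertRank-here with u ≟ u
  ... | yes _ = refl
  ... | no u≢u = contradiction refl u≢u

  insertRank-there : ∀ {z} → z ≢ u → insertRank z ≡ suc (2 * r z)
  insertRank-there {z} z≢u with z ≟ u
  ... | yes z≡u = contradiction z≡u z≢u
  ... | no _ = refl

  insertRank-injective : Injective _≡_ _≡_ r → Injective _≡_ _≡_ insertRank
  insertRank-injective r-injective {x} {y} eq with x ≟ u | y ≟ u
  ... | yes x≡u | yes y≡u = trans x≡u (sym y≡u)
  ... | yes _ | no _ = contradiction eq (even≢odd c (r y))
  ... | no _ | yes _ = contradiction (sym eq) (even≢odd c (r x))
  ... | no _ | no _ = r-injective (*-cancelˡ-≡ (r x) (r y) 2 (suc-injective eq))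

  insertRank-mono : ∀ {a b} → a ≢ u → b ≢ u → r a < r b → insertRank a < insertRank b
  insertRank-mono a≢u b≢u ra<rb rewrite insertRank-there a≢u | insertRank-there b≢u =
    s≤s (*-monoʳ-< 2 ra<rb)

insertRank-below : ∀ (r : Fin n → ℕ) {u w} → w ≢ u → insertRank r u (r w) u < insertRank r u (r w) w
insertRank-below r {u} {w} w≢u rewrite insertRank-here r u (r w) | insertRank-there r u (r w) w≢u =
  n<1+n (2 * r w)

insertRank-above : ∀ (r : Fin n → ℕ) {u w} → w ≢ u → insertRank r u (suc (r w)) w < insertRank r u (suc (r w)) u
insertRank-above r {u} {w} w≢u rewrite insertRank-here r u (suc (r w)) | insertRank-there r u (suc (r w)) w≢u =
  ≤-reflexive (sym (*-suc 2 (r w)))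

Ranking : List (Fin n × Fin n) → Set
Ranking {n} π = Σ (Fin n → ℕ) λ r → Injective _≡_ _≡_ r × All (uncurry λ a b → r a < r b) π

touches? : (u : Fin n) → Decidable (λ (p : Fin n × Fin n) → u ∈ₛ uncurry edge p)
touches? u = (u ∈?_) ∘ uncurry edge

ranking-extend : ∀ {π : List (Fin n × Fin n)} {u x y} → x ≢ y → u ∈ₛ edge x y →
  filter (touches? u) π ≡ [ (x , y) ] → Ranking (filter (∁? (touches? u)) π) → Ranking π
ranking-extend {π = π} {u} {x} {y} x≢y u∈xy touching (r , r-injective , r-ordered) =
  insertRank r u c , insertRank-injective r u c r-injective , All.tabulate ordered
  where
  leaf-ordered : ∃ λ c → insertRank r u c x < insertRank r u c y
  leaf-ordered with ∈-edge⁻ u∈xy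
  ... | inj₁ refl = r y , insertRank-below r (x≢y ∘ sym)
  ... | inj₂ refl = suc (r x) , insertRank-above r x≢y
  c : ℕ
  c = proj₁ leaf-ordered
  ordered : ∀ {q} → q ∈ₗ π → uncurry (λ a b → insertRank r u c a < insertRank r u c b) q
  ordered {a , b} q∈π with touches? u (a , b)
  ... | yes u∈ab with subst ((a , b) ∈ₗ_) touching (∈-filter⁺ (touches? u) q∈π u∈ab)
  ...   | here refl = proj₂ leaf-ordered
  ordered {a , b} q∈π | no u∉ab = insertRank-mono r u c
    (λ { refl → u∉ab ∈-edgeˡ }) (λ { refl → u∉ab ∈-edgeʳ })
    (All.lookup r-ordered (∈-filter⁺ (∁? (touches? u)) q∈π u∉ab))

orientation-pairs : ∀ {τ : List (Subset n)} (o : Orientation τ) → map (uncurry edge) (tabulate (proj₁ ∘ o)) ≡ τ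
orientation-pairs {τ = τ} o =
  trans (map-tabulate (proj₁ ∘ o) (uncurry edge)) (trans (tabulate-cong (proj₂ ∘ o)) (tabulate-lookup τ))

module _ {τ : List (Subset n)} (sizes : All IsPair τ) (degenerate : OneDegenerate τ) where

  ranking : ∀ k (π : List (Fin n × Fin n)) → length π ≡ k → map (uncurry edge) π ⊆ τ → Ranking π
  ranking _ [] _ _ = toℕ , toℕ-injective , []
  ranking (suc k) π@(_ ∷ _) len π⊆τ with degenerate (map (uncurry edge) π) π⊆τ (λ ())
  ... | u , leaf with filter (touches? u) π in touching
                    | trans (sym (length-filter-map (u ∈?_) (uncurry edge) π)) leaf
  ... | (x , y) ∷ [] | _ with ∈-filter⁻ (touches? u) {xs = π} (subst ((x , y) ∈ₗ_) (sym touching) (here refl))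
  ...   | xy∈π , u∈xy = ranking-extend x≢y u∈xy touching (ranking k π' length-π' π'⊆τ)
    where
    π' : List (Fin n × Fin n)
    π' = filter (∁? (touches? u)) π
    x≢y : x ≢ y
    x≢y = ∣edge∣≡2⇒≢ (All.lookup (All-resp-⊆ π⊆τ sizes) (∈-map⁺ (uncurry edge) xy∈π))
    length-π' : length π' ≡ k
    length-π' = suc-injective (trans (sym (trans (length-filter-∁ (touches? u) π)
      (cong (λ l → length l + length π') touching))) len)
    π'⊆τ : map (uncurry edge) π' ⊆ τ
    π'⊆τ = ⊆-trans (map⁺ (uncurry edge) (filter-⊆ (∁? (touches? u)) π)) π⊆τ

  oneDegenerate⇒flexible : TotalOrderFlexible τ
  oneDegenerate⇒flexible o =
    let π = tabulate (proj₁ ∘ o)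
        r , r-injective , r-ordered = ranking (length π) π refl (subst (_⊆ τ) (sym (orientation-pairs o)) ⊆-refl)
    in (λ a b → r a < r b) , rank-isStrictTotalOrder r r-injective , λ i → All.lookup r-ordered (∈-tabulate⁺ i)

-- Walks and cycles

record NonBacktrackingWalk (σ : List (Subset n)) (v : ℕ → Fin n) : Set where
  field
    step∈ : ∀ t → edge (v t) (v (suc t)) ∈ₗ σ
    moves : ∀ t → v (suc t) ≢ v t
    no-return : ∀ t → v (suc (suc t)) ≢ v t

walk-⊆ : ∀ {σ τ : List (Subset n)} {v} → σ ⊆ τ → NonBacktrackingWalk σ v → NonBacktrackingWalk τ v
walk-⊆ σ⊆τ walk = record { step∈ = Any-resp-⊆ σ⊆τ ∘ step∈ ; moves = moves ; no-return = no-return }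
  where open NonBacktrackingWalk walk

module _ {σ : List (Subset n)} (unique : Unique σ) (sizes : All IsPair σ) (leafless : Leafless σ) where

  another-edge : ∀ {s u} → s ∈ₗ σ → u ∈ₛ s → ∃ λ s' → s' ∈ₗ σ × u ∈ₛ s' × s' ≢ s
  another-edge {s} {u} s∈σ u∈s
    with ∈-avoiding (≡-dec Bool._≟_) (Unique.filter⁺ (u ∈?_) unique) (leafless u (∈L⁺ (lose s∈σ u∈s))) s
  ... | s' , s'∈ , s'≢s with ∈-filter⁻ (u ∈?_) {xs = σ} s'∈
  ...   | s'∈σ , u∈s' = s' , s'∈σ , u∈s' , s'≢s

  record Dart : Set where
    constructor dart
    field
      tip : Fin n
      along : Subset n
      along∈σ : along ∈ₗ σ
      tip∈along : tip ∈ₛ along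
  open Dart

  advance : (d : Dart) → Σ Dart λ d' → edge (tip d) (tip d') ≡ along d' × tip d' ≢ tip d × along d' ≢ along d
  advance (dart u s s∈σ u∈s) with another-edge s∈σ u∈s
  ... | s' , s'∈σ , u∈s' , s'≢s with other-end (All.lookup sizes s'∈σ) u∈s'
  ...   | w , w≢u , uw≡s' = dart w s' s'∈σ (subst (w ∈ₛ_) uw≡s' ∈-edgeʳ) , uw≡s' , w≢u , s'≢s

  leafless-walk : ∀ {s} → s ∈ₗ σ → ∃ (NonBacktrackingWalk σ)
  leafless-walk {s} s∈σ = tip ∘ darts , record { step∈ = step∈ ; moves = moves ; no-return = no-return }
    where
    start : Dart
    start with ∣s∣≡2⇒edge s (All.lookup sizes s∈σ)
    ... | a , b , ab≡s = dart a s s∈σ (subst (a ∈ₛ_) ab≡s ∈-edgeˡ)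
    darts : ℕ → Dart
    darts zero = start
    darts (suc t) = proj₁ (advance (darts t))
    v : ℕ → Fin n
    v = tip ∘ darts
    edge≡along : ∀ t → edge (v t) (v (suc t)) ≡ along (darts (suc t))
    edge≡along t = proj₁ (proj₂ (advance (darts t)))
    step∈ : ∀ t → edge (v t) (v (suc t)) ∈ₗ σ
    step∈ t = subst (_∈ₗ σ) (sym (edge≡along t)) (along∈σ (darts (suc t)))
    moves : ∀ t → v (suc t) ≢ v t
    moves t = proj₁ (proj₂ (proj₂ (advance (darts t))))
    no-return : ∀ t → v (suc (suc t)) ≢ v t
    no-return t v₂≡v₀ = proj₂ (proj₂ (proj₂ (advance (darts (suc t))))) (begin
      along (darts (suc (suc t)))         ≡⟨ edge≡along (suc t) ⟨
      edge (v (suc t)) (v (suc (suc t)))  ≡⟨ cong (edge (v (suc t))) v₂≡v₀ ⟩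
      edge (v (suc t)) (v t)              ≡⟨ edge-comm ⟩
      edge (v t) (v (suc t))              ≡⟨ edge≡along t ⟩
      along (darts (suc t))               ∎)
      where open ≡-Reasoning

InjectiveBelow : ∀ {a} {A : Set a} → (ℕ → A) → ℕ → Set a
InjectiveBelow v k = ∀ {s t} → s < k → t < k → v s ≡ v t → s ≡ t

InjectiveBelow-suc : ∀ {a} {A : Set a} {v : ℕ → A} {k} → InjectiveBelow v k → (∀ {s} → s < k → v s ≢ v k) →
  InjectiveBelow v (suc k)
InjectiveBelow-suc injective fresh s<1+k t<1+k vs≡vt
  with m≤n⇒m<n∨m≡n (≤-pred s<1+k) | m≤n⇒m<n∨m≡n (≤-pred t<1+k)
... | inj₁ s<k | inj₁ t<k = injective s<k t<k vs≡vt
... | inj₁ s<k | inj₂ refl = contradiction vs≡vt (fresh s<k)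
... | inj₂ refl | inj₁ t<k = contradiction (sym vs≡vt) (fresh t<k)
... | inj₂ refl | inj₂ refl = refl

injective-or-repeat : (v : ℕ → Fin n) → ∀ k →
  InjectiveBelow v k ⊎ ∃₂ λ i j → i < j × v j ≡ v i × InjectiveBelow v j
injective-or-repeat v zero = inj₁ λ ()
injective-or-repeat v (suc k) with injective-or-repeat v k
... | inj₂ repeat = inj₂ repeat
... | inj₁ injective with any? (λ (i : Fin k) → v (toℕ i) ≟ v k)
...   | yes (i , vi≡vk) = inj₂ (toℕ i , k , toℕ<n i , sym vi≡vk , injective)
...   | no ∄i = inj₁ (InjectiveBelow-suc injective λ s<k vs≡vk →
          ∄i (fromℕ< s<k , trans (cong v (toℕ-fromℕ< s<k)) vs≡vk))

first-repeat : (v : ℕ → Fin n) → ∃₂ λ i j → i < j × v j ≡ v i × InjectiveBelow v j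
first-repeat {n} v with injective-or-repeat v (suc n)
... | inj₂ repeat = repeat
... | inj₁ injective with pigeonhole (n<1+n n) (v ∘ toℕ)
...   | i , j , i<j , vi≡vj = contradiction (injective (toℕ<n i) (toℕ<n j) vi≡vj) (<⇒≢ i<j)

module _ {τ : List (Subset n)} (sizes : All IsPair τ) {v : ℕ → Fin n} (walk : NonBacktrackingWalk τ v)
         {i j : ℕ} (i<j : i < j) (closed : v j ≡ v i) (injective : InjectiveBelow v j) where
  open NonBacktrackingWalk walk

  j≢1+i : j ≢ suc i
  j≢1+i refl = moves i closed

  j≢2+i : j ≢ suc (suc i)
  j≢2+i refl = no-return i closed

  pos : Fin n → ℕ
  pos x with any? (λ (k : Fin j) → v (toℕ k) ≟ x)
  ... | yes (k , _) = toℕ k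
  ... | no _ = 0

  pos-v : ∀ {t} → t < j → pos (v t) ≡ t
  pos-v {t} t<j with any? (λ (k : Fin j) → v (toℕ k) ≟ v t)
  ... | yes (k , vk≡vt) = injective (toℕ<n k) t<j vk≡vt
  ... | no ∄k = contradiction (fromℕ< t<j , cong v (toℕ-fromℕ< t<j)) ∄k

  next : ℕ → ℕ
  next p with suc p ℕ.≟ j
  ... | yes _ = i
  ... | no _ = suc p

  next∘next≢id : ∀ t → next (next t) ≢ t
  next∘next≢id t with suc t ℕ.≟ j
  ... | yes 1+t≡j with suc i ℕ.≟ j
  ...   | yes 1+i≡j = contradiction (sym 1+i≡j) j≢1+i
  ...   | no _ = λ 1+i≡t → j≢2+i (trans (sym 1+t≡j) (cong suc (sym 1+i≡t)))
  next∘next≢id t | no _ with suc (suc t) ℕ.≟ j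
  ...   | yes 2+t≡j = λ i≡t → j≢2+i (trans (sym 2+t≡j) (cong (λ p → suc (suc p)) (sym i≡t)))
  ...   | no _ = m≢1+n+m t {1} ∘ sym

  pos-next : ∀ {t} → t < j → pos (v (suc t)) ≡ next t
  pos-next {t} t<j with suc t ℕ.≟ j
  ... | yes 1+t≡j = trans (cong (pos ∘ v) 1+t≡j) (trans (cong pos closed) (pos-v i<j))
  ... | no 1+t≢j = pos-v (≤∧≢⇒< t<j 1+t≢j)

  orient : Fin n → Fin n → Fin n × Fin n
  orient a b with pos b ℕ.≟ next (pos a)
  ... | yes _ = a , b
  ... | no _ = b , a

  edge-orient : ∀ a b → uncurry edge (orient a b) ≡ edge a b
  edge-orient a b with pos b ℕ.≟ next (pos a)
  ... | yes _ = refl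
  ... | no _ = edge-comm

  orient-along : ∀ {t} → t < j → ∀ {a b} → edge a b ≡ edge (v t) (v (suc t)) → orient a b ≡ (v t , v (suc t))
  orient-along {t} t<j {a} {b} ab≡step with edge-injective (moves t ∘ sym) ab≡step
  ... | inj₁ (refl , refl) with pos b ℕ.≟ next (pos a)
  ...   | yes _ = refl
  ...   | no ¬forward = contradiction (trans (pos-next t<j) (cong next (sym (pos-v t<j)))) ¬forward
  orient-along {t} t<j {a} {b} ab≡step | inj₂ (refl , refl) with pos b ℕ.≟ next (pos a)
  ...   | yes backward = contradiction
          (trans (sym (pos-v t<j)) (trans backward (cong next (pos-next t<j)))) (next∘next≢id t ∘ sym)
  ...   | no _ = refl

  endpoints : (k : Fin (length τ)) → ∃₂ λ a b → edge a b ≡ lookup τ k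
  endpoints k = ∣s∣≡2⇒edge (lookup τ k) (All.lookup sizes (∈-lookup k))

  cycle-orientation : Orientation τ
  cycle-orientation k = let a , b , ab≡s = endpoints k in orient a b , trans (edge-orient a b) ab≡s

  cycle-not-flexible : ¬ TotalOrderFlexible τ
  cycle-not-flexible flexible = irrefl refl (subst (v i ≺_) closed (ascending j i<j ≤-refl))
    where
    _≺_ : Fin n → Fin n → Set
    _≺_ = proj₁ (flexible cycle-orientation)
    open IsStrictTotalOrder (proj₁ (proj₂ (flexible cycle-orientation))) using (irrefl) renaming (trans to ≺-trans)
    step : ∀ {t} → t < j → v t ≺ v (suc t)
    step {t} t<j = subst (uncurry _≺_) along respected
      where
      k : Fin (length τ)
      k = Any.index (step∈ t)
      a b : Fin n
      a = proj₁ (endpoints k)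
      b = proj₁ (proj₂ (endpoints k))
      respected : uncurry _≺_ (orient a b)
      respected = proj₂ (proj₂ (flexible cycle-orientation)) k
      along : orient a b ≡ (v t , v (suc t))
      along = orient-along t<j (trans (proj₂ (proj₂ (endpoints k))) (sym (lookup-index (step∈ t))))
    ascending : ∀ t → i < t → t ≤ j → v i ≺ v t
    ascending (suc t) i<1+t 1+t≤j with m≤n⇒m<n∨m≡n (≤-pred i<1+t)
    ... | inj₁ i<t = ≺-trans (ascending t i<t (<⇒≤ 1+t≤j)) (step 1+t≤j)
    ... | inj₂ refl = step 1+t≤j

leafless-not-flexible : ∀ {τ σ : List (Subset n)} {s} → Unique τ → All IsPair τ →
  TotalOrderFlexible τ → σ ⊆ τ → s ∈ₗ σ → ¬ Leafless σ
leafless-not-flexible unique sizes flexible σ⊆τ s∈σ leafless =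
  let v , walk = leafless-walk (Unique-resp-⊆ σ⊆τ unique) (All-resp-⊆ σ⊆τ sizes) leafless s∈σ
      _ , _ , i<j , closed , injective = first-repeat v
  in cycle-not-flexible sizes (walk-⊆ σ⊆τ walk) i<j closed injective flexible

flexible⇒oneDegenerate : ∀ {τ : List (Subset n)} → Unique τ → All IsPair τ →
  TotalOrderFlexible τ → OneDegenerate τ
flexible⇒oneDegenerate _ _ _ [] _ []≢[] = contradiction refl []≢[]
flexible⇒oneDegenerate unique sizes flexible σ@(_ ∷ _) σ⊆τ _ with leaf? σ
... | inj₁ leaf = leaf
... | inj₂ leafless = contradiction leafless (leafless-not-flexible unique sizes flexible σ⊆τ (here refl))

theorem3 : (n : ℕ) (τ : List (Subset n)) → IsPairFamily τ →
    (Thin τ → TotalOrderFlexible τ) × (TotalOrderFlexible τ → Thin τ)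
theorem3 n τ (_ , unique , sizes) =
  (λ thin → oneDegenerate⇒flexible sizes (thin⇒oneDegenerate sizes thin)) ,
  (λ flexible → oneDegenerate⇒thin sizes (flexible⇒oneDegenerate unique sizes flexible))
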